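{- Let $G$ be a mixed graph on a finite vertex set with $n \geq 2$ vertices, with $E_1$ its set of non-edges, $E_2$ its set of non-oriented edges, $E_3$ its set of oriented edges, and $\overline{E_3}$ the set $E_3$ with all orientations reversed. Let $\mathcal{P}_0$ be the set of permutations $\mathbf{x}$ of $G$ with $E(\mathbf{x})\cap\overline{E_3}=\emptyset$; for $i\in\{1,2\}$ let $\mathcal{P}_i$ be the set of permutations $\mathbf{x}$ of $G$ with $E(\mathbf{x})\cap(E_i\cup\overline{E_3})=\emptyset$; and let $\mathcal{P}_3=\mathcal{P}_1\cap\mathcal{P}_2$. Then $|\mathcal{P}_0|+|\mathcal{P}_1|+|\mathcal{P}_2|+|\mathcal{P}_3|$ is even.
   Context: A mixed graph $G$ on a finite vertex set $V$: each unordered pair of distinct vertices is exactly one of: a non-edge (the set of these is $E_1$), a non-oriented edge (the set of these is $E_2$), or an oriented edge in one of the two possible directions (the set of these ordered pairs is $E_3$). $\overline{E_3}=\{(y,x) : (x,y)\in E_3\}$. A permutation of $G$ is an ordering $\mathbf{x}=(x_1,\dots,x_n)$ of all vertices of $G$. For $1\le i\le n-1$, the neighboring pair of $x_i,x_{i+1}$ is the unordered pair $\{x_i,x_{i+1}\}$ if this pair lies in $E_1\cup E_2$, and otherwise it is the ordered pair $(x_i,x_{i+1})$, which then lies in $E_3$ or in $\overline{E_3}$. $E(\mathbf{x})$ denotes the set of the $n-1$ neighboring pairs of $\mathbf{x}$. -}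

module Defs where

open import Data.Nat using (ℕ; zero; suc; _≥_)
open import Data.Fin using (Fin)
open import Data.Bool using (Bool; true; false; _∧_; not)
open import Data.List using (List; []; _∷_; map; concatMap; filterᵇ; length; allFin)
open import Data.Vec using (Vec; []; _∷_; toList)
open import Relation.Binary.PropositionalEquality using (_≡_)
open import Relation.Nullary using (¬_)
open import Relation.Nullary.Decidable using (⌊_⌋)
open import Data.Fin.Properties using (_≟_)

-- Type of an ordered pair (x , y) of distinct vertices.
data PairType : Set where
  nonEdge : PairType
  edge    : PairType
  arcFwd  : PairType   -- (x,y) ∈ E₃
  arcBwd  : PairType   -- (y,x) ∈ E₃, i.e. (x,y) ∈ conj(E₃)

flipType : PairType → PairType
flipType nonEdge = nonEdge
flipType edge    = edge
flipType arcFwd  = arcBwd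
flipType arcBwd  = arcFwd

-- A mixed graph on the vertex set Fin n: every unordered pair of distinct
-- vertices has exactly one type, consistently seen from both endpoints.
-- (Values on the diagonal are irrelevant and never used.)
record MixedGraph (n : ℕ) : Set where
  field
    type       : Fin n → Fin n → PairType
    consistent : ∀ x y → ¬ (x ≡ y) → type y x ≡ flipType (type x y)

isE₁ : PairType → Bool
isE₁ nonEdge = true
isE₁ _       = false

isE₂ : PairType → Bool
isE₂ edge = true
isE₂ _    = false

isE₃bar : PairType → Bool
isE₃bar arcBwd = true
isE₃bar _      = false

allVecs : (n k : ℕ) → List (Vec (Fin n) k)
allVecs n zero    = [] ∷ []
allVecs n (suc k) = concatMap (λ v → map (λ a → a ∷ v) (allFin n)) (allVecs n k)

notElem : ∀ {n} → Fin n → List (Fin n) → Bool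
notElem a []       = true
notElem a (b ∷ bs) = not ⌊ a ≟ b ⌋ ∧ notElem a bs

distinct : ∀ {n} → List (Fin n) → Bool
distinct []       = true
distinct (a ∷ as) = notElem a as ∧ distinct as

-- Permutations of G: orderings (x₁,…,xₙ) of all n vertices, i.e. length-n
-- vectors over Fin n without repetition.
permutations : (n : ℕ) → List (Vec (Fin n) n)
permutations n = filterᵇ (λ v → distinct (toList v)) (allVecs n n)

avoids : ∀ {n} → (PairType → Bool) → MixedGraph n → List (Fin n) → Bool
avoids bad G []           = true
avoids bad G (a ∷ [])     = true
avoids bad G (a ∷ b ∷ xs) = not (bad (MixedGraph.type G a b)) ∧ avoids bad G (b ∷ xs)

_∨ᵇ_ : Bool → Bool → Bool
true  ∨ᵇ _ = true
false ∨ᵇ b = b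

countAvoiding : ∀ {n} → MixedGraph n → (PairType → Bool) → ℕ
countAvoiding {n} G bad = length (filterᵇ (λ v → avoids bad G (toList v)) (permutations n))

P₀ P₁ P₂ P₃ : ∀ {n} → MixedGraph n → ℕ
P₀ G = countAvoiding G isE₃bar
P₁ G = countAvoiding G (λ t → isE₁ t ∨ᵇ isE₃bar t)
P₂ G = countAvoiding G (λ t → isE₂ t ∨ᵇ isE₃bar t)
P₃ G = countAvoiding G (λ t → isE₁ t ∨ᵇ (isE₂ t ∨ᵇ isE₃bar t))

-- Counting mod 2 (counts are Booleans, ⨁ is the xor-sum), P₀ and P₃ have the same parity, and so do
-- P₁ and P₂. Call a permutation a c-chain if every neighbouring pair (xᵢ , xᵢ₊₁) satisfies the
-- relation c. Each Pᵢ counts the c-chains for some c, and reversing permutations identifies the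
-- chains counted by P₃ (resp. P₂) with the chains of the complement of the relation of P₀ (resp. P₁).
-- So it suffices that, for any relation c, the numbers of c-chains and of cᶜ-chains agree mod 2.
-- Mod 2 the indicator of a cᶜ-chain x is ∏ (1 + c (xᵢ , xᵢ₊₁)); expanding the product sums over
-- all cuttings of x into consecutive c-runs. The single-run term is the indicator of a c-chain, and
-- the terms with at least two runs, x = P ++ Q ++ R with leading runs P and Q, cancel in pairs
-- when summed over all permutations, by exchanging P and Q.
module Submission where

open import Defs
open import Data.Nat using (ℕ; zero; suc; _+_; _*_; _≥_)
open import Data.Nat.Properties using (*-suc)
open import Data.Bool using (Bool; true; false; not; _∧_; _xor_; T)
open import Data.Bool.Properties
  using (∧-zeroʳ; ∧-identityʳ; ∧-assoc; ∧-comm; ∧-distribˡ-xor; ∧-distribʳ-xor; ∧-commutativeMonoid; xor-∧-commutativeRing;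
         xor-assoc; xor-same; xor-identityʳ; not-distribˡ-xor; not-involutive; T-∧; T-≡; ⇔→≡; ¬-not)
open import Data.List using (List; []; _∷_; _++_; _∷ʳ_; map; concatMap; filterᵇ; length; allFin; reverse; null)
open import Data.List.Properties using (unfold-reverse)
open import Data.Fin using (Fin)
open import Data.Fin.Properties using (_≟_)
open import Data.Vec using (toList) renaming (_∷_ to _∷ᵥ_)
open import Data.List.Relation.Unary.All using (All; []; _∷_)
open import Data.List.Relation.Unary.AllPairs using ([]; _∷_)
open import Data.List.Relation.Unary.Any using (here)
open import Data.List.Relation.Unary.Unique.Propositional using (Unique)
open import Data.List.Relation.Unary.Unique.Propositional.Properties using (Unique[x∷xs]⇒x∉xs)
open import Data.List.Membership.Propositional.Properties using (∈-++⁺ˡ; ∈-++⁺ʳ)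
open import Data.List.Relation.Binary.Permutation.Propositional using (_↭_; ↭-sym; ↭⇒↭ₛ)
open import Data.List.Relation.Binary.Permutation.Propositional.Properties using (↭-reverse; ++-comm; ++⁺ʳ)
import Data.List.Relation.Binary.Permutation.Setoid.Properties as PermutationProperties
open import Data.Unit using (tt)
open import Data.Product using (_×_; _,_; proj₁; proj₂; ∃; uncurry; map₁)
open import Function using (_⇔_; mk⇔; Equivalence; flip)
open import Relation.Binary.PropositionalEquality
open import Relation.Nullary.Decidable using (toWitnessFalse; fromWitnessFalse)
open ≡-Reasoning

open import Algebra.Bundles using (CommutativeRing; CommutativeMonoid)
import Algebra.Properties.CommutativeSemigroup as CommSemigroupProps

private
  variable
    A B : Set

  module xor = CommSemigroupProps (CommutativeRing.+-commutativeSemigroup xor-∧-commutativeRing)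
  module ∧ = CommSemigroupProps (CommutativeMonoid.commutativeSemigroup ∧-commutativeMonoid)

-- Sums mod 2

xor-cancel-middle : ∀ p s q → (p xor s) xor (s xor q) ≡ p xor q
xor-cancel-middle p s q = begin
  (p xor s) xor (s xor q)   ≡⟨ xor-assoc p s _ ⟩
  p xor (s xor (s xor q))   ≡⟨ cong (p xor_) (sym (xor-assoc s s q)) ⟩
  p xor ((s xor s) xor q)   ≡⟨ cong (λ z → p xor (z xor q)) (xor-same s) ⟩
  p xor q                   ∎

xorSum : List A → (A → Bool) → Bool
xorSum []       f = false
xorSum (x ∷ xs) f = f x xor xorSum xs f

infixr 5 xorSum
syntax xorSum xs (λ x → e) = ⨁[ x ∈ xs ] e

xorSum-cong : ∀ (xs : List A) {f g : A → Bool} → (∀ x → f x ≡ g x) → xorSum xs f ≡ xorSum xs g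
xorSum-cong []       eq = refl
xorSum-cong (x ∷ xs) eq = cong₂ _xor_ (eq x) (xorSum-cong xs eq)

xorSum-false : ∀ (xs : List A) {f : A → Bool} → (∀ x → f x ≡ false) → xorSum xs f ≡ false
xorSum-false []       eq = refl
xorSum-false (x ∷ xs) eq = cong₂ _xor_ (eq x) (xorSum-false xs eq)

xorSum-xor : ∀ (xs : List A) (f g : A → Bool) →
  ⨁[ x ∈ xs ] (f x xor g x) ≡ xorSum xs f xor xorSum xs g
xorSum-xor []       f g = refl
xorSum-xor (x ∷ xs) f g =
  trans (cong ((f x xor g x) xor_) (xorSum-xor xs f g)) (xor.interchange (f x) (g x) _ _)

∧-distribˡ-xorSum : ∀ b (xs : List A) (f : A → Bool) → b ∧ xorSum xs f ≡ ⨁[ x ∈ xs ] (b ∧ f x)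
∧-distribˡ-xorSum b []       f = ∧-zeroʳ b
∧-distribˡ-xorSum b (x ∷ xs) f =
  trans (∧-distribˡ-xor b (f x) _) (cong ((b ∧ f x) xor_) (∧-distribˡ-xorSum b xs f))

xorSum-++ : ∀ (xs ys : List A) (f : A → Bool) → xorSum (xs ++ ys) f ≡ xorSum xs f xor xorSum ys f
xorSum-++ []       ys f = refl
xorSum-++ (x ∷ xs) ys f = trans (cong (f x xor_) (xorSum-++ xs ys f)) (sym (xor-assoc (f x) _ _))

xorSum-map : ∀ (g : B → A) (ys : List B) (f : A → Bool) → xorSum (map g ys) f ≡ ⨁[ y ∈ ys ] f (g y)
xorSum-map g []       f = refl
xorSum-map g (y ∷ ys) f = cong (f (g y) xor_) (xorSum-map g ys f)

xorSum-concatMap : ∀ (g : B → List A) (ys : List B) (f : A → Bool) →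
  xorSum (concatMap g ys) f ≡ ⨁[ y ∈ ys ] xorSum (g y) f
xorSum-concatMap g []       f = refl
xorSum-concatMap g (y ∷ ys) f =
  trans (xorSum-++ (g y) (concatMap g ys) f) (cong (xorSum (g y) f xor_) (xorSum-concatMap g ys f))

xorSum-comm : ∀ (xs : List A) (ys : List B) (h : A → B → Bool) →
  ⨁[ x ∈ xs ] ⨁[ y ∈ ys ] h x y ≡ ⨁[ y ∈ ys ] ⨁[ x ∈ xs ] h x y
xorSum-comm []       ys h = sym (xorSum-false ys (λ _ → refl))
xorSum-comm (x ∷ xs) ys h =
  trans (cong (xorSum ys (h x) xor_) (xorSum-comm xs ys h))
        (sym (xorSum-xor ys (h x) (λ y → ⨁[ x′ ∈ xs ] h x′ y)))

-- Off-diagonal terms come in equal pairs.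
xorSum-symmetric : ∀ (xs : List A) (h : A → A → Bool) → (∀ x y → h x y ≡ h y x) →
  ⨁[ x ∈ xs ] ⨁[ y ∈ xs ] h x y ≡ ⨁[ x ∈ xs ] h x x
xorSum-symmetric []       h sym-h = refl
xorSum-symmetric (a ∷ xs) h sym-h = begin
  (h a a xor xorSum xs (h a)) xor ⨁[ x ∈ xs ] (h x a xor xorSum xs (h x))
    ≡⟨ cong ((h a a xor xorSum xs (h a)) xor_) (xorSum-xor xs (λ x → h x a) (λ x → xorSum xs (h x))) ⟩
  (h a a xor xorSum xs (h a)) xor ((⨁[ x ∈ xs ] h x a) xor ⨁[ x ∈ xs ] xorSum xs (h x))
    ≡⟨ cong₂ (λ u v → (h a a xor xorSum xs (h a)) xor (u xor v))
             (xorSum-cong xs (λ x → sym-h x a)) (xorSum-symmetric xs h sym-h) ⟩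
  (h a a xor xorSum xs (h a)) xor (xorSum xs (h a) xor ⨁[ x ∈ xs ] h x x)
    ≡⟨ xor-cancel-middle (h a a) (xorSum xs (h a)) _ ⟩
  h a a xor ⨁[ x ∈ xs ] h x x
    ∎

xorSum-filterᵇ : ∀ (xs : List A) (p f : A → Bool) → xorSum (filterᵇ p xs) f ≡ ⨁[ x ∈ xs ] (p x ∧ f x)
xorSum-filterᵇ []       p f = refl
xorSum-filterᵇ (x ∷ xs) p f with p x
... | true  = cong (f x xor_) (xorSum-filterᵇ xs p f)
... | false = xorSum-filterᵇ xs p f

isOdd : ℕ → Bool
isOdd zero    = false
isOdd (suc m) = not (isOdd m)

isOdd-+ : ∀ m k → isOdd (m + k) ≡ isOdd m xor isOdd k
isOdd-+ zero    k = refl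
isOdd-+ (suc m) k = trans (cong not (isOdd-+ m k)) (not-distribˡ-xor (isOdd m) (isOdd k))

isOdd≡false⇒even : ∀ m → isOdd m ≡ false → ∃ λ k → m ≡ 2 * k
isOdd≡false⇒even zero          _    = 0 , refl
isOdd≡false⇒even (suc zero)    ()
isOdd≡false⇒even (suc (suc m)) even
  with isOdd≡false⇒even m (trans (sym (not-involutive (isOdd m))) even)
... | k , m≡2k = suc k , trans (cong (2 +_) m≡2k) (sym (*-suc 2 k))

isOdd-length-filterᵇ : ∀ (xs : List A) p → isOdd (length (filterᵇ p xs)) ≡ xorSum xs p
isOdd-length-filterᵇ []       p = refl
isOdd-length-filterᵇ (x ∷ xs) p with p x
... | true  = cong not (isOdd-length-filterᵇ xs p)
... | false = isOdd-length-filterᵇ xs p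

-- Splittings of lists and of numbers

splits : List A → List (List A × List A)
splits []       = ([] , []) ∷ []
splits (a ∷ xs) = ([] , a ∷ xs) ∷ map (map₁ (a ∷_)) (splits xs)

sumSplits : List A → (List A → List A → Bool) → Bool
sumSplits xs g = ⨁[ p ∈ splits xs ] uncurry g p

infixr 5 sumSplits
syntax sumSplits xs (λ P Y → e) = ⨁[ P ⁀ Y ≔ xs ] e

sumSplits-cons : ∀ a (xs : List A) g →
  sumSplits (a ∷ xs) g ≡ g [] (a ∷ xs) xor ⨁[ P ⁀ Y ≔ xs ] g (a ∷ P) Y
sumSplits-cons a xs g = cong (g [] (a ∷ xs) xor_) (xorSum-map (map₁ (a ∷_)) (splits xs) (uncurry g))

sumSplits-cong : ∀ (xs : List A) {g h : List A → List A → Bool} →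
  (∀ P Y → g P Y ≡ h P Y) → sumSplits xs g ≡ sumSplits xs h
sumSplits-cong xs eq = xorSum-cong (splits xs) (λ p → eq _ _)

∧-distribˡ-sumSplits : ∀ (xs : List A) (h : List A → Bool) g →
  h xs ∧ sumSplits xs g ≡ ⨁[ P ⁀ Y ≔ xs ] (h (P ++ Y) ∧ g P Y)
∧-distribˡ-sumSplits []       h g = ∧-distribˡ-xorSum (h []) (splits []) (uncurry g)
∧-distribˡ-sumSplits (a ∷ xs) h g = begin
  h (a ∷ xs) ∧ sumSplits (a ∷ xs) g
    ≡⟨ cong (h (a ∷ xs) ∧_) (sumSplits-cons a xs g) ⟩
  h (a ∷ xs) ∧ (g [] (a ∷ xs) xor ⨁[ P ⁀ Y ≔ xs ] g (a ∷ P) Y)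
    ≡⟨ ∧-distribˡ-xor (h (a ∷ xs)) _ _ ⟩
  (h (a ∷ xs) ∧ g [] (a ∷ xs)) xor (h (a ∷ xs) ∧ (⨁[ P ⁀ Y ≔ xs ] g (a ∷ P) Y))
    ≡⟨ cong ((h (a ∷ xs) ∧ g [] (a ∷ xs)) xor_)
            (∧-distribˡ-sumSplits xs (λ z → h (a ∷ z)) (λ P Y → g (a ∷ P) Y)) ⟩
  (h (a ∷ xs) ∧ g [] (a ∷ xs)) xor ⨁[ P ⁀ Y ≔ xs ] (h (a ∷ P ++ Y) ∧ g (a ∷ P) Y)
    ≡⟨ sym (sumSplits-cons a xs (λ P Y → h (P ++ Y) ∧ g P Y)) ⟩
  ⨁[ P ⁀ Y ≔ a ∷ xs ] (h (P ++ Y) ∧ g P Y)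
    ∎

sumSplits-emptySuffix : ∀ (xs : List A) (f : List A → Bool) →
  ⨁[ P ⁀ Y ≔ xs ] (f P ∧ null Y) ≡ f xs
sumSplits-emptySuffix []       f = trans (xor-identityʳ _) (∧-identityʳ (f []))
sumSplits-emptySuffix (a ∷ xs) f = begin
  ⨁[ P ⁀ Y ≔ a ∷ xs ] (f P ∧ null Y)
    ≡⟨ sumSplits-cons a xs (λ P Y → f P ∧ null Y) ⟩
  (f [] ∧ false) xor ⨁[ P ⁀ Y ≔ xs ] (f (a ∷ P) ∧ null Y)
    ≡⟨ cong₂ _xor_ (∧-zeroʳ (f [])) (sumSplits-emptySuffix xs (λ P → f (a ∷ P))) ⟩
  f (a ∷ xs)
    ∎

sumSplits-assoc : ∀ (xs : List A) (k : List A → List A → List A → Bool) →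
  ⨁[ P ⁀ Y ≔ xs ] ⨁[ Q ⁀ R ≔ Y ] k P Q R ≡ ⨁[ Z ⁀ R ≔ xs ] ⨁[ P ⁀ Q ≔ Z ] k P Q R
sumSplits-assoc []       k = refl
sumSplits-assoc (a ∷ xs) k = begin
  ⨁[ P ⁀ Y ≔ a ∷ xs ] ⨁[ Q ⁀ R ≔ Y ] k P Q R
    ≡⟨ sumSplits-cons a xs (λ P Y → ⨁[ Q ⁀ R ≔ Y ] k P Q R) ⟩
  sumSplits (a ∷ xs) (k []) xor ⨁[ P ⁀ Y ≔ xs ] ⨁[ Q ⁀ R ≔ Y ] k (a ∷ P) Q R
    ≡⟨ cong₂ _xor_ (sumSplits-cons a xs (k [])) (sumSplits-assoc xs (λ P → k (a ∷ P))) ⟩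
  (k [] [] (a ∷ xs) xor ⨁[ Q ⁀ R ≔ xs ] k [] (a ∷ Q) R) xor ⨁[ Z ⁀ R ≔ xs ] ⨁[ P ⁀ Q ≔ Z ] k (a ∷ P) Q R
    ≡⟨ xor-assoc (k [] [] (a ∷ xs)) _ _ ⟩
  k [] [] (a ∷ xs) xor ((⨁[ Q ⁀ R ≔ xs ] k [] (a ∷ Q) R) xor ⨁[ Z ⁀ R ≔ xs ] ⨁[ P ⁀ Q ≔ Z ] k (a ∷ P) Q R)
    ≡⟨ cong (k [] [] (a ∷ xs) xor_) (sym (xorSum-xor (splits xs) _ _)) ⟩
  k [] [] (a ∷ xs) xor ⨁[ Z ⁀ R ≔ xs ] (k [] (a ∷ Z) R xor ⨁[ P ⁀ Q ≔ Z ] k (a ∷ P) Q R)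
    ≡⟨ cong (k [] [] (a ∷ xs) xor_) (sumSplits-cong xs (λ Z R → sym (sumSplits-cons a Z (λ P Q → k P Q R)))) ⟩
  k [] [] (a ∷ xs) xor ⨁[ Z ⁀ R ≔ xs ] ⨁[ P ⁀ Q ≔ a ∷ Z ] k P Q R
    ≡⟨ cong (λ z → z xor ⨁[ Z ⁀ R ≔ xs ] ⨁[ P ⁀ Q ≔ a ∷ Z ] k P Q R) (sym (xor-identityʳ (k [] [] (a ∷ xs)))) ⟩
  (k [] [] (a ∷ xs) xor false) xor ⨁[ Z ⁀ R ≔ xs ] ⨁[ P ⁀ Q ≔ a ∷ Z ] k P Q R
    ≡⟨ sym (sumSplits-cons a xs (λ Z R → ⨁[ P ⁀ Q ≔ Z ] k P Q R)) ⟩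
  ⨁[ Z ⁀ R ≔ a ∷ xs ] ⨁[ P ⁀ Q ≔ Z ] k P Q R
    ∎

antidiagonal : ℕ → List (ℕ × ℕ)
antidiagonal zero    = (0 , 0) ∷ []
antidiagonal (suc k) = (0 , suc k) ∷ map (map₁ suc) (antidiagonal k)

sumAntidiagonal : ℕ → (ℕ → ℕ → Bool) → Bool
sumAntidiagonal k f = ⨁[ p ∈ antidiagonal k ] uncurry f p

infixr 5 sumAntidiagonal
syntax sumAntidiagonal k (λ j l → e) = ⨁[ j + l ≔ k ] e

sumAntidiagonal-suc : ∀ k f →
  sumAntidiagonal (suc k) f ≡ f 0 (suc k) xor ⨁[ j + l ≔ k ] f (suc j) l
sumAntidiagonal-suc k f = cong (f 0 (suc k) xor_) (xorSum-map (map₁ suc) (antidiagonal k) (uncurry f))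

sumAntidiagonal-cong : ∀ k {f g : ℕ → ℕ → Bool} →
  (∀ j l → f j l ≡ g j l) → sumAntidiagonal k f ≡ sumAntidiagonal k g
sumAntidiagonal-cong k eq = xorSum-cong (antidiagonal k) (λ p → eq _ _)

sumAntidiagonal-snoc : ∀ k f →
  sumAntidiagonal (suc k) f ≡ (⨁[ j + l ≔ k ] f j (suc l)) xor f (suc k) 0
sumAntidiagonal-snoc zero f
  rewrite xor-identityʳ (f 0 1) | xor-identityʳ (f 1 0) = refl
sumAntidiagonal-snoc (suc k) f = begin
  sumAntidiagonal (suc (suc k)) f
    ≡⟨ sumAntidiagonal-suc (suc k) f ⟩
  f 0 (2 + k) xor ⨁[ j + l ≔ suc k ] f (suc j) l
    ≡⟨ cong (f 0 (2 + k) xor_) (sumAntidiagonal-snoc k (λ j → f (suc j))) ⟩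
  f 0 (2 + k) xor ((⨁[ j + l ≔ k ] f (suc j) (suc l)) xor f (2 + k) 0)
    ≡⟨ sym (xor-assoc (f 0 (2 + k)) _ _) ⟩
  (f 0 (2 + k) xor ⨁[ j + l ≔ k ] f (suc j) (suc l)) xor f (2 + k) 0
    ≡⟨ cong (_xor f (2 + k) 0) (sym (sumAntidiagonal-suc k (λ j l → f j (suc l)))) ⟩
  (⨁[ j + l ≔ suc k ] f j (suc l)) xor f (2 + k) 0
    ∎

-- The terms f j l and f l j cancel, and the middle term (if any) lies on the diagonal.
sumAntidiagonal-symmetric : ∀ k (f : ℕ → ℕ → Bool) →
  (∀ j l → f j l ≡ f l j) → (∀ j → f j j ≡ false) → sumAntidiagonal k f ≡ false
sumAntidiagonal-symmetric zero          f sym-f diag = trans (xor-identityʳ (f 0 0)) (diag 0)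
sumAntidiagonal-symmetric (suc zero)    f sym-f diag =
  trans (cong (f 0 1 xor_) (trans (xor-identityʳ (f 1 0)) (sym-f 1 0))) (xor-same (f 0 1))
sumAntidiagonal-symmetric (suc (suc k)) f sym-f diag = begin
  sumAntidiagonal (2 + k) f
    ≡⟨ sumAntidiagonal-suc (suc k) f ⟩
  f 0 (2 + k) xor ⨁[ j + l ≔ suc k ] f (suc j) l
    ≡⟨ cong (f 0 (2 + k) xor_) (sumAntidiagonal-snoc k (λ j → f (suc j))) ⟩
  f 0 (2 + k) xor ((⨁[ j + l ≔ k ] f (suc j) (suc l)) xor f (2 + k) 0)
    ≡⟨ cong₂ (λ u v → f 0 (2 + k) xor (u xor v))
             (sumAntidiagonal-symmetric k (λ j l → f (suc j) (suc l))
                                          (λ j l → sym-f (suc j) (suc l)) (λ j → diag (suc j)))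
             (sym-f (2 + k) 0) ⟩
  f 0 (2 + k) xor f 0 (2 + k)
    ≡⟨ xor-same (f 0 (2 + k)) ⟩
  false
    ∎

sumLists : ∀ {n} → ℕ → (List (Fin n) → Bool) → Bool
sumLists {n} k f = ⨁[ v ∈ allVecs n k ] f (toList v)

infixr 5 sumLists
syntax sumLists k (λ x → e) = ⨁[ x ∈ lists k ] e

module _ {n : ℕ} where

  sumLists-cong : ∀ k {f g : List (Fin n) → Bool} → (∀ x → f x ≡ g x) → sumLists k f ≡ sumLists k g
  sumLists-cong k eq = xorSum-cong (allVecs n k) (λ v → eq (toList v))

  sumLists-false : ∀ k {f : List (Fin n) → Bool} → (∀ x → f x ≡ false) → sumLists k f ≡ false
  sumLists-false k eq = xorSum-false (allVecs n k) (λ v → eq (toList v))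

  sumLists-suc : ∀ k (f : List (Fin n) → Bool) →
    sumLists (suc k) f ≡ ⨁[ v ∈ lists k ] ⨁[ a ∈ allFin n ] f (a ∷ v)
  sumLists-suc k f =
    trans (xorSum-concatMap (λ v → map (_∷ᵥ v) (allFin n)) (allVecs n k) (λ v → f (toList v)))
          (xorSum-cong (allVecs n k) (λ v → xorSum-map (_∷ᵥ v) (allFin n) (λ w → f (toList w))))

  sumLists-comm : ∀ j k (h : List (Fin n) → List (Fin n) → Bool) →
    ⨁[ x ∈ lists j ] ⨁[ y ∈ lists k ] h x y ≡ ⨁[ y ∈ lists k ] ⨁[ x ∈ lists j ] h x y
  sumLists-comm j k h = xorSum-comm (allVecs n j) (allVecs n k) (λ v w → h (toList v) (toList w))

  sumLists-snoc : ∀ k (f : List (Fin n) → Bool) →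
    sumLists (suc k) f ≡ ⨁[ v ∈ lists k ] ⨁[ a ∈ allFin n ] f (v ∷ʳ a)
  sumLists-snoc zero    f = sumLists-suc zero f
  sumLists-snoc (suc k) f = begin
    sumLists (2 + k) f
      ≡⟨ sumLists-suc (suc k) f ⟩
    ⨁[ v ∈ lists (suc k) ] ⨁[ a ∈ allFin n ] f (a ∷ v)
      ≡⟨ sumLists-snoc k (λ v → ⨁[ a ∈ allFin n ] f (a ∷ v)) ⟩
    ⨁[ w ∈ lists k ] ⨁[ b ∈ allFin n ] ⨁[ a ∈ allFin n ] f (a ∷ w ∷ʳ b)
      ≡⟨ sumLists-cong k (λ w → xorSum-comm (allFin n) (allFin n) (λ b a → f (a ∷ w ∷ʳ b))) ⟩
    ⨁[ w ∈ lists k ] ⨁[ a ∈ allFin n ] ⨁[ b ∈ allFin n ] f (a ∷ w ∷ʳ b)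
      ≡⟨ sym (sumLists-suc k (λ v → ⨁[ b ∈ allFin n ] f (v ∷ʳ b))) ⟩
    ⨁[ v ∈ lists (suc k) ] ⨁[ b ∈ allFin n ] f (v ∷ʳ b)
      ∎

  sumLists-reverse : ∀ k (f : List (Fin n) → Bool) → ⨁[ x ∈ lists k ] f (reverse x) ≡ sumLists k f
  sumLists-reverse zero    f = refl
  sumLists-reverse (suc k) f = begin
    ⨁[ x ∈ lists (suc k) ] f (reverse x)
      ≡⟨ sumLists-suc k (λ x → f (reverse x)) ⟩
    ⨁[ v ∈ lists k ] ⨁[ a ∈ allFin n ] f (reverse (a ∷ v))
      ≡⟨ sumLists-cong k (λ v → xorSum-cong (allFin n) (λ a → cong f (unfold-reverse a v))) ⟩
    ⨁[ v ∈ lists k ] ⨁[ a ∈ allFin n ] f (reverse v ∷ʳ a)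
      ≡⟨ sumLists-reverse k (λ w → ⨁[ a ∈ allFin n ] f (w ∷ʳ a)) ⟩
    ⨁[ w ∈ lists k ] ⨁[ a ∈ allFin n ] f (w ∷ʳ a)
      ≡⟨ sym (sumLists-snoc k f) ⟩
    sumLists (suc k) f
      ∎

  sumLists-splits : ∀ k (g : List (Fin n) → List (Fin n) → Bool) →
    ⨁[ x ∈ lists k ] ⨁[ P ⁀ Y ≔ x ] g P Y ≡ ⨁[ j + l ≔ k ] ⨁[ P ∈ lists j ] ⨁[ Y ∈ lists l ] g P Y
  sumLists-splits zero    g = sym (xor-identityʳ _)
  sumLists-splits (suc k) g = begin
    ⨁[ x ∈ lists (suc k) ] ⨁[ P ⁀ Y ≔ x ] g P Y
      ≡⟨ sumLists-suc k (λ x → ⨁[ P ⁀ Y ≔ x ] g P Y) ⟩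
    ⨁[ v ∈ lists k ] ⨁[ a ∈ allFin n ] ⨁[ P ⁀ Y ≔ a ∷ v ] g P Y
      ≡⟨ sumLists-cong k (λ v → xorSum-cong (allFin n) (λ a → sumSplits-cons a v g)) ⟩
    ⨁[ v ∈ lists k ] ⨁[ a ∈ allFin n ] (g [] (a ∷ v) xor ⨁[ P ⁀ Y ≔ v ] g (a ∷ P) Y)
      ≡⟨ sumLists-cong k (λ v → xorSum-xor (allFin n) (λ a → g [] (a ∷ v)) (λ a → ⨁[ P ⁀ Y ≔ v ] g (a ∷ P) Y)) ⟩
    ⨁[ v ∈ lists k ] ((⨁[ a ∈ allFin n ] g [] (a ∷ v)) xor ⨁[ a ∈ allFin n ] ⨁[ P ⁀ Y ≔ v ] g (a ∷ P) Y)
      ≡⟨ xorSum-xor (allVecs n k) _ _ ⟩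
    (⨁[ v ∈ lists k ] ⨁[ a ∈ allFin n ] g [] (a ∷ v)) xor
      ⨁[ v ∈ lists k ] ⨁[ a ∈ allFin n ] ⨁[ P ⁀ Y ≔ v ] g (a ∷ P) Y
      ≡⟨ cong₂ _xor_ (sym (sumLists-suc k (g [])))
                     (sumLists-cong k (λ v → xorSum-comm (allFin n) (splits v) (λ a → uncurry (λ P → g (a ∷ P))))) ⟩
    sumLists (suc k) (g []) xor ⨁[ v ∈ lists k ] ⨁[ P ⁀ Y ≔ v ] ⨁[ a ∈ allFin n ] g (a ∷ P) Y
      ≡⟨ cong₂ _xor_ (sym (xor-identityʳ (sumLists (suc k) (g []))))
                     (sumLists-splits k (λ P Y → ⨁[ a ∈ allFin n ] g (a ∷ P) Y)) ⟩
    (sumLists (suc k) (g []) xor false) xor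
      ⨁[ j + l ≔ k ] ⨁[ P ∈ lists j ] ⨁[ Y ∈ lists l ] ⨁[ a ∈ allFin n ] g (a ∷ P) Y
      ≡⟨ cong ((sumLists (suc k) (g []) xor false) xor_) (sumAntidiagonal-cong k prependToFirst) ⟩
    (sumLists (suc k) (g []) xor false) xor ⨁[ j + l ≔ k ] ⨁[ P ∈ lists (suc j) ] ⨁[ Y ∈ lists l ] g P Y
      ≡⟨ sym (sumAntidiagonal-suc k (λ j l → ⨁[ P ∈ lists j ] ⨁[ Y ∈ lists l ] g P Y)) ⟩
    ⨁[ j + l ≔ suc k ] ⨁[ P ∈ lists j ] ⨁[ Y ∈ lists l ] g P Y
      ∎
    where
    prependToFirst : ∀ j l →
      ⨁[ P ∈ lists j ] ⨁[ Y ∈ lists l ] ⨁[ a ∈ allFin n ] g (a ∷ P) Y ≡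
      ⨁[ P ∈ lists (suc j) ] ⨁[ Y ∈ lists l ] g P Y
    prependToFirst j l =
      trans (sumLists-cong j (λ P → xorSum-comm (allVecs n l) (allFin n) (λ Y a → g (a ∷ P) (toList Y))))
            (sym (sumLists-suc j (λ P → sumLists l (g P))))

  sumLists-splits-symmetric : ∀ k (w : List (Fin n) → List (Fin n) → Bool) →
    (∀ P Q → w P Q ≡ w Q P) → (∀ P → w P P ≡ false) → ⨁[ Z ∈ lists k ] ⨁[ P ⁀ Q ≔ Z ] w P Q ≡ false
  sumLists-splits-symmetric k w sym-w diag-w =
    trans (sumLists-splits k w)
          (sumAntidiagonal-symmetric k (λ j l → ⨁[ P ∈ lists j ] ⨁[ Q ∈ lists l ] w P Q)
            (λ j l → trans (sumLists-comm j l w) (sumLists-cong l (λ Q → sumLists-cong j (λ P → sym-w P Q))))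
            (λ j → trans (xorSum-symmetric (allVecs n j) (λ P Q → w (toList P) (toList Q)) (λ P Q → sym-w (toList P) (toList Q)))
                         (sumLists-false j diag-w)))

-- Chains

chain : (A → A → Bool) → List A → Bool
chain c []           = true
chain c (a ∷ [])     = true
chain c (a ∷ b ∷ xs) = c a b ∧ chain c (b ∷ xs)

infix 10 _ᶜ
_ᶜ : (A → A → Bool) → A → A → Bool
(c ᶜ) a b = not (c a b)

nonemptyChain : (A → A → Bool) → List A → Bool
nonemptyChain c xs = not (null xs) ∧ chain c xs

module _ (c : A → A → Bool) where

  chain-∷ʳ : ∀ xs b a → chain c (xs ∷ʳ b ∷ʳ a) ≡ chain c (xs ∷ʳ b) ∧ c b a
  chain-∷ʳ []           b a = ∧-identityʳ (c b a)
  chain-∷ʳ (y ∷ [])     b a =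
    trans (cong (c y b ∧_) (∧-identityʳ (c b a))) (cong (_∧ c b a) (sym (∧-identityʳ (c y b))))
  chain-∷ʳ (y ∷ z ∷ ys) b a =
    trans (cong (c y z ∧_) (chain-∷ʳ (z ∷ ys) b a)) (sym (∧-assoc (c y z) _ _))

  chain-reverse : ∀ xs → chain c (reverse xs) ≡ chain (flip c) xs
  chain-reverse []           = refl
  chain-reverse (a ∷ [])     = refl
  chain-reverse (a ∷ b ∷ xs) = begin
    chain c (reverse (a ∷ b ∷ xs))
      ≡⟨ cong (chain c) (trans (unfold-reverse a (b ∷ xs)) (cong (_∷ʳ a) (unfold-reverse b xs))) ⟩
    chain c (reverse xs ∷ʳ b ∷ʳ a)
      ≡⟨ chain-∷ʳ (reverse xs) b a ⟩
    chain c (reverse xs ∷ʳ b) ∧ c b a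
      ≡⟨ cong (λ ys → chain c ys ∧ c b a) (sym (unfold-reverse b xs)) ⟩
    chain c (reverse (b ∷ xs)) ∧ c b a
      ≡⟨ cong (_∧ c b a) (chain-reverse (b ∷ xs)) ⟩
    chain (flip c) (b ∷ xs) ∧ c b a
      ≡⟨ ∧-comm _ (c b a) ⟩
    chain (flip c) (a ∷ b ∷ xs)
      ∎

  -- Mod 2, chain (c ᶜ) is the product of 1 + c over the adjacent pairs; expanding it, group the terms
  -- by the first pair whose factor is taken to be 1.
  chainᶜ-firstRun : ∀ a xs → ⨁[ P ⁀ Y ≔ xs ] (chain c (a ∷ P) ∧ chain (c ᶜ) Y) ≡ chain (c ᶜ) (a ∷ xs)
  chainᶜ-firstRun a []       = refl
  chainᶜ-firstRun a (b ∷ xs) = begin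
    ⨁[ P ⁀ Y ≔ b ∷ xs ] (chain c (a ∷ P) ∧ chain (c ᶜ) Y)
      ≡⟨ sumSplits-cons b xs (λ P Y → chain c (a ∷ P) ∧ chain (c ᶜ) Y) ⟩
    chain (c ᶜ) (b ∷ xs) xor ⨁[ P ⁀ Y ≔ xs ] ((c a b ∧ chain c (b ∷ P)) ∧ chain (c ᶜ) Y)
      ≡⟨ cong (chain (c ᶜ) (b ∷ xs) xor_) (begin
           ⨁[ P ⁀ Y ≔ xs ] ((c a b ∧ chain c (b ∷ P)) ∧ chain (c ᶜ) Y)
             ≡⟨ sumSplits-cong xs (λ P Y → ∧-assoc (c a b) _ _) ⟩
           ⨁[ P ⁀ Y ≔ xs ] (c a b ∧ (chain c (b ∷ P) ∧ chain (c ᶜ) Y))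
             ≡⟨ sym (∧-distribˡ-xorSum (c a b) (splits xs) _) ⟩
           c a b ∧ (⨁[ P ⁀ Y ≔ xs ] (chain c (b ∷ P) ∧ chain (c ᶜ) Y))
             ≡⟨ cong (c a b ∧_) (chainᶜ-firstRun b xs) ⟩
           c a b ∧ chain (c ᶜ) (b ∷ xs)
             ∎) ⟩
    chain (c ᶜ) (b ∷ xs) xor (c a b ∧ chain (c ᶜ) (b ∷ xs))
      ≡⟨ sym (∧-distribʳ-xor (chain (c ᶜ) (b ∷ xs)) true (c a b)) ⟩
    chain (c ᶜ) (a ∷ b ∷ xs)
      ∎

  runThenᶜ : List A → Bool
  runThenᶜ Y = ⨁[ Q ⁀ R ≔ Y ] (nonemptyChain c Q ∧ chain (c ᶜ) R)

  chainᶜ-expand : ∀ xs → chain (c ᶜ) xs ≡ null xs xor runThenᶜ xs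
  chainᶜ-expand []       = refl
  chainᶜ-expand (a ∷ xs) =
    sym (trans (sumSplits-cons a xs (λ Q R → nonemptyChain c Q ∧ chain (c ᶜ) R)) (chainᶜ-firstRun a xs))

  -- The term of the expansion of chain (c ᶜ) x in which x is a single run is chain c x.
  chain-xor-chainᶜ : ∀ xs → chain c xs xor chain (c ᶜ) xs ≡ ⨁[ P ⁀ Y ≔ xs ] (nonemptyChain c P ∧ runThenᶜ Y)
  chain-xor-chainᶜ []       = refl
  chain-xor-chainᶜ (a ∷ xs) = begin
    chain c x xor chain (c ᶜ) x
      ≡⟨ cong (chain c x xor_) (chainᶜ-expand x) ⟩
    chain c x xor ⨁[ P ⁀ Y ≔ x ] (run P ∧ chain (c ᶜ) Y)
      ≡⟨ cong (chain c x xor_) (sumSplits-cong x (λ P Y →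
           trans (cong (run P ∧_) (chainᶜ-expand Y)) (∧-distribˡ-xor (run P) (null Y) (runThenᶜ Y)))) ⟩
    chain c x xor ⨁[ P ⁀ Y ≔ x ] ((run P ∧ null Y) xor (run P ∧ runThenᶜ Y))
      ≡⟨ cong (chain c x xor_) (xorSum-xor (splits x) (uncurry (λ P Y → run P ∧ null Y))
                                                      (uncurry (λ P Y → run P ∧ runThenᶜ Y))) ⟩
    chain c x xor ((⨁[ P ⁀ Y ≔ x ] (run P ∧ null Y)) xor twoRuns)
      ≡⟨ cong (λ z → chain c x xor (z xor twoRuns)) (sumSplits-emptySuffix x run) ⟩
    chain c x xor (chain c x xor twoRuns)
      ≡⟨ sym (xor-assoc (chain c x) (chain c x) twoRuns) ⟩
    (chain c x xor chain c x) xor twoRuns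
      ≡⟨ cong (_xor twoRuns) (xor-same (chain c x)) ⟩
    twoRuns
      ∎
    where
    x : List A
    x = a ∷ xs
    run : List A → Bool
    run = nonemptyChain c
    twoRuns : Bool
    twoRuns = ⨁[ P ⁀ Y ≔ x ] (run P ∧ runThenᶜ Y)

chain-cong-Unique : ∀ {c c′ : A → A → Bool} → (∀ a b → a ≢ b → c a b ≡ c′ a b) →
  ∀ {xs} → Unique xs → chain c xs ≡ chain c′ xs
chain-cong-Unique eq []                              = refl
chain-cong-Unique eq (_ ∷ [])                        = refl
chain-cong-Unique eq {a ∷ b ∷ _} ((a≢b ∷ _) ∷ unique) = cong₂ _∧_ (eq a b a≢b) (chain-cong-Unique eq unique)

module _ {n : ℕ} where
  open Equivalence using (to; from)
  open PermutationProperties (setoid (Fin n)) using (Unique-resp-↭)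

  T-notElem⇔All≢ : ∀ (a : Fin n) xs → T (notElem a xs) ⇔ All (a ≢_) xs
  T-notElem⇔All≢ a []       = mk⇔ (λ _ → []) (λ _ → tt)
  T-notElem⇔All≢ a (b ∷ xs) = mk⇔
    (λ t → toWitnessFalse {a? = a ≟ b} (proj₁ (to T-∧ t)) ∷ to (T-notElem⇔All≢ a xs) (proj₂ (to T-∧ t)))
    (λ { (a≢b ∷ rest) → from T-∧ (fromWitnessFalse {a? = a ≟ b} a≢b , from (T-notElem⇔All≢ a xs) rest) })

  T-distinct⇔Unique : ∀ (xs : List (Fin n)) → T (distinct xs) ⇔ Unique xs
  T-distinct⇔Unique []       = mk⇔ (λ _ → []) (λ _ → tt)
  T-distinct⇔Unique (a ∷ xs) = mk⇔
    (λ t → to (T-notElem⇔All≢ a xs) (proj₁ (to T-∧ t)) ∷ to (T-distinct⇔Unique xs) (proj₂ (to T-∧ t)))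
    (λ { (a∉xs ∷ unique) → from T-∧ (from (T-notElem⇔All≢ a xs) a∉xs , from (T-distinct⇔Unique xs) unique) })

  distinct≡true⇒Unique : ∀ {xs : List (Fin n)} → distinct xs ≡ true → Unique xs
  distinct≡true⇒Unique {xs} d = to (T-distinct⇔Unique xs) (from T-≡ d)

  distinct-resp-↭ : ∀ {xs ys : List (Fin n)} → xs ↭ ys → distinct xs ≡ distinct ys
  distinct-resp-↭ xs↭ys = ⇔→≡ {z = true} (mk⇔ (transport xs↭ys) (transport (↭-sym xs↭ys)))
    where
    transport : ∀ {xs ys} → xs ↭ ys → distinct xs ≡ true → distinct ys ≡ true
    transport {ys = ys} p d = to T-≡ (from (T-distinct⇔Unique ys) (Unique-resp-↭ (↭⇒↭ₛ p) (distinct≡true⇒Unique d)))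

  distinct-reverse : ∀ (xs : List (Fin n)) → distinct (reverse xs) ≡ distinct xs
  distinct-reverse xs = distinct-resp-↭ (↭-reverse xs)

  distinct-swap : ∀ (P Q R : List (Fin n)) → distinct ((P ++ Q) ++ R) ≡ distinct ((Q ++ P) ++ R)
  distinct-swap P Q R = distinct-resp-↭ (++⁺ʳ R (++-comm P Q))

  distinct-repeat : ∀ a (P R : List (Fin n)) → distinct (((a ∷ P) ++ (a ∷ P)) ++ R) ≡ false
  distinct-repeat a P R =
    ¬-not (λ d → Unique[x∷xs]⇒x∉xs (distinct≡true⇒Unique d) (∈-++⁺ˡ (∈-++⁺ʳ P (here refl))))

  distinct-∧-chain-cong : ∀ {c c′ : Fin n → Fin n → Bool} → (∀ a b → a ≢ b → c a b ≡ c′ a b) →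
    ∀ xs → distinct xs ∧ chain c xs ≡ distinct xs ∧ chain c′ xs
  distinct-∧-chain-cong eq xs with distinct xs in d
  ... | false = refl
  ... | true  = chain-cong-Unique eq {xs} (distinct≡true⇒Unique d)

-- Chains of a relation and of its complement

module _ {n : ℕ} (c : Fin n → Fin n → Bool) where

  private
    twoRunsThenᶜ : List (Fin n) → List (Fin n) → List (Fin n) → Bool
    twoRunsThenᶜ P Q R = nonemptyChain c P ∧ (nonemptyChain c Q ∧ chain (c ᶜ) R)

    weight : List (Fin n) → List (Fin n) → List (Fin n) → Bool
    weight R P Q = distinct ((P ++ Q) ++ R) ∧ twoRunsThenᶜ P Q R

    weight-swap : ∀ R P Q → weight R P Q ≡ weight R Q P
    weight-swap R P Q =
      cong₂ _∧_ (distinct-swap P Q R) (∧.x∙yz≈y∙xz (nonemptyChain c P) (nonemptyChain c Q) (chain (c ᶜ) R))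

    weight-diagonal : ∀ R P → weight R P P ≡ false
    weight-diagonal R []      = ∧-zeroʳ (distinct R)
    weight-diagonal R (a ∷ P) = cong (_∧ twoRunsThenᶜ (a ∷ P) (a ∷ P) R) (distinct-repeat a P R)

    decompose : ∀ x → chain c x xor chain (c ᶜ) x ≡ ⨁[ Z ⁀ R ≔ x ] ⨁[ P ⁀ Q ≔ Z ] twoRunsThenᶜ P Q R
    decompose x = begin
      chain c x xor chain (c ᶜ) x
        ≡⟨ chain-xor-chainᶜ c x ⟩
      ⨁[ P ⁀ Y ≔ x ] (nonemptyChain c P ∧ runThenᶜ c Y)
        ≡⟨ sumSplits-cong x (λ P Y → ∧-distribˡ-xorSum (nonemptyChain c P) (splits Y) _) ⟩
      ⨁[ P ⁀ Y ≔ x ] ⨁[ Q ⁀ R ≔ Y ] twoRunsThenᶜ P Q R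
        ≡⟨ sumSplits-assoc x twoRunsThenᶜ ⟩
      ⨁[ Z ⁀ R ≔ x ] ⨁[ P ⁀ Q ≔ Z ] twoRunsThenᶜ P Q R
        ∎

  distinct-∧-chain-xor-chainᶜ : ∀ k → ⨁[ x ∈ lists k ] (distinct x ∧ (chain c x xor chain (c ᶜ) x)) ≡ false
  distinct-∧-chain-xor-chainᶜ k = begin
    ⨁[ x ∈ lists k ] (distinct x ∧ (chain c x xor chain (c ᶜ) x))
      ≡⟨ sumLists-cong k (λ x → cong (distinct x ∧_) (decompose x)) ⟩
    ⨁[ x ∈ lists k ] (distinct x ∧ (⨁[ Z ⁀ R ≔ x ] ⨁[ P ⁀ Q ≔ Z ] twoRunsThenᶜ P Q R))
      ≡⟨ sumLists-cong k (λ x → ∧-distribˡ-sumSplits x distinct _) ⟩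
    ⨁[ x ∈ lists k ] ⨁[ Z ⁀ R ≔ x ] (distinct (Z ++ R) ∧ (⨁[ P ⁀ Q ≔ Z ] twoRunsThenᶜ P Q R))
      ≡⟨ sumLists-cong k (λ x → sumSplits-cong x (λ Z R →
           ∧-distribˡ-sumSplits Z (λ z → distinct (z ++ R)) (λ P Q → twoRunsThenᶜ P Q R))) ⟩
    ⨁[ x ∈ lists k ] ⨁[ Z ⁀ R ≔ x ] ⨁[ P ⁀ Q ≔ Z ] weight R P Q
      ≡⟨ sumLists-splits k (λ Z R → ⨁[ P ⁀ Q ≔ Z ] weight R P Q) ⟩
    ⨁[ j + l ≔ k ] ⨁[ Z ∈ lists j ] ⨁[ R ∈ lists l ] ⨁[ P ⁀ Q ≔ Z ] weight R P Q
      ≡⟨ sumAntidiagonal-cong k (λ j l →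
           trans (sumLists-comm j l (λ Z R → ⨁[ P ⁀ Q ≔ Z ] weight R P Q))
                 (sumLists-false l (λ R → sumLists-splits-symmetric j (weight R) (weight-swap R) (weight-diagonal R)))) ⟩
    ⨁[ j + l ≔ k ] false
      ≡⟨ xorSum-false (antidiagonal k) (λ _ → refl) ⟩
    false
      ∎

xor≡false⇒≡ : ∀ {a b} → a xor b ≡ false → a ≡ b
xor≡false⇒≡ {true}  {true}  _ = refl
xor≡false⇒≡ {false} {false} _ = refl

module _ {n : ℕ} {c c′ : Fin n → Fin n → Bool} (reversedComplement : ∀ a b → a ≢ b → c′ b a ≡ not (c a b)) where

  distinct-∧-chain-reversedComplement : ∀ k →
    ⨁[ x ∈ lists k ] (distinct x ∧ chain c x) ≡ ⨁[ x ∈ lists k ] (distinct x ∧ chain c′ x)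
  distinct-∧-chain-reversedComplement k = xor≡false⇒≡ (begin
    (⨁[ x ∈ lists k ] (distinct x ∧ chain c x)) xor ⨁[ x ∈ lists k ] (distinct x ∧ chain c′ x)
      ≡⟨ cong ((⨁[ x ∈ lists k ] (distinct x ∧ chain c x)) xor_) reversal ⟩
    (⨁[ x ∈ lists k ] (distinct x ∧ chain c x)) xor ⨁[ x ∈ lists k ] (distinct x ∧ chain (c ᶜ) x)
      ≡⟨ sym (xorSum-xor (allVecs n k) _ _) ⟩
    ⨁[ x ∈ lists k ] ((distinct x ∧ chain c x) xor (distinct x ∧ chain (c ᶜ) x))
      ≡⟨ sumLists-cong k (λ x → sym (∧-distribˡ-xor (distinct x) (chain c x) (chain (c ᶜ) x))) ⟩
    ⨁[ x ∈ lists k ] (distinct x ∧ (chain c x xor chain (c ᶜ) x))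
      ≡⟨ distinct-∧-chain-xor-chainᶜ c k ⟩
    false
      ∎)
    where
    reversal : ⨁[ x ∈ lists k ] (distinct x ∧ chain c′ x) ≡ ⨁[ x ∈ lists k ] (distinct x ∧ chain (c ᶜ) x)
    reversal = begin
      ⨁[ x ∈ lists k ] (distinct x ∧ chain c′ x)
        ≡⟨ sym (sumLists-reverse k (λ x → distinct x ∧ chain c′ x)) ⟩
      ⨁[ x ∈ lists k ] (distinct (reverse x) ∧ chain c′ (reverse x))
        ≡⟨ sumLists-cong k (λ x → cong₂ _∧_ (distinct-reverse x) (chain-reverse c′ x)) ⟩
      ⨁[ x ∈ lists k ] (distinct x ∧ chain (flip c′) x)
        ≡⟨ sumLists-cong k (distinct-∧-chain-cong reversedComplement) ⟩
      ⨁[ x ∈ lists k ] (distinct x ∧ chain (c ᶜ) x)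
        ∎

-- Permutations of a mixed graph

allowed : ∀ {n} → MixedGraph n → (PairType → Bool) → Fin n → Fin n → Bool
allowed G bad a b = not (bad (MixedGraph.type G a b))

avoids≡chain : ∀ {n} (bad : PairType → Bool) (G : MixedGraph n) xs → avoids bad G xs ≡ chain (allowed G bad) xs
avoids≡chain bad G []           = refl
avoids≡chain bad G (a ∷ [])     = refl
avoids≡chain bad G (a ∷ b ∷ xs) = cong (allowed G bad a b ∧_) (avoids≡chain bad G (b ∷ xs))

isOdd-countAvoiding : ∀ {n} (G : MixedGraph n) bad →
  isOdd (countAvoiding G bad) ≡ ⨁[ x ∈ lists n ] (distinct x ∧ chain (allowed G bad) x)
isOdd-countAvoiding {n} G bad = begin
  isOdd (countAvoiding G bad)
    ≡⟨ isOdd-length-filterᵇ (permutations n) (λ v → avoids bad G (toList v)) ⟩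
  ⨁[ v ∈ permutations n ] avoids bad G (toList v)
    ≡⟨ xorSum-filterᵇ (allVecs n n) (λ v → distinct (toList v)) (λ v → avoids bad G (toList v)) ⟩
  ⨁[ x ∈ lists n ] (distinct x ∧ avoids bad G x)
    ≡⟨ sumLists-cong n (λ x → cong (distinct x ∧_) (avoids≡chain bad G x)) ⟩
  ⨁[ x ∈ lists n ] (distinct x ∧ chain (allowed G bad) x)
    ∎

isOdd-countAvoiding-reversedComplement : ∀ {n} (G : MixedGraph n) {bad bad′ : PairType → Bool} →
  (∀ t → bad′ (flipType t) ≡ not (bad t)) → isOdd (countAvoiding G bad) ≡ isOdd (countAvoiding G bad′)
isOdd-countAvoiding-reversedComplement {n} G {bad} {bad′} flip-bad′ =
  trans (isOdd-countAvoiding G bad)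
        (trans (distinct-∧-chain-reversedComplement reversedComplement n) (sym (isOdd-countAvoiding G bad′)))
  where
  open MixedGraph G
  reversedComplement : ∀ a b → a ≢ b → allowed G bad′ b a ≡ not (allowed G bad a b)
  reversedComplement a b a≢b = trans (cong (λ t → not (bad′ t)) (consistent a b a≢b)) (cong not (flip-bad′ (type a b)))

flip-forbidden₃ : ∀ t → (isE₁ (flipType t) ∨ᵇ (isE₂ (flipType t) ∨ᵇ isE₃bar (flipType t))) ≡ not (isE₃bar t)
flip-forbidden₃ nonEdge = refl
flip-forbidden₃ edge    = refl
flip-forbidden₃ arcFwd  = refl
flip-forbidden₃ arcBwd  = refl

flip-forbidden₂ : ∀ t → (isE₂ (flipType t) ∨ᵇ isE₃bar (flipType t)) ≡ not (isE₁ t ∨ᵇ isE₃bar t)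
flip-forbidden₂ nonEdge = refl
flip-forbidden₂ edge    = refl
flip-forbidden₂ arcFwd  = refl
flip-forbidden₂ arcBwd  = refl

xor-pairs-cancel : ∀ a b → ((a xor b) xor b) xor a ≡ false
xor-pairs-cancel true  true  = refl
xor-pairs-cancel true  false = refl
xor-pairs-cancel false true  = refl
xor-pairs-cancel false false = refl

mainTheorem6 : (n : ℕ) → n ≥ 2 → (G : MixedGraph n) →
    ∃ λ k → P₀ G + P₁ G + P₂ G + P₃ G ≡ 2 * k
mainTheorem6 n _ G = isOdd≡false⇒even (P₀ G + P₁ G + P₂ G + P₃ G) (begin
  isOdd (P₀ G + P₁ G + P₂ G + P₃ G)
    ≡⟨ trans (isOdd-+ (P₀ G + P₁ G + P₂ G) (P₃ G))
             (cong (_xor isOdd (P₃ G)) (trans (isOdd-+ (P₀ G + P₁ G) (P₂ G))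
                                              (cong (_xor isOdd (P₂ G)) (isOdd-+ (P₀ G) (P₁ G))))) ⟩
  ((isOdd (P₀ G) xor isOdd (P₁ G)) xor isOdd (P₂ G)) xor isOdd (P₃ G)
    ≡⟨ cong₂ (λ p₂ p₃ → ((isOdd (P₀ G) xor isOdd (P₁ G)) xor p₂) xor p₃)
             (sym (isOdd-countAvoiding-reversedComplement G flip-forbidden₂))
             (sym (isOdd-countAvoiding-reversedComplement G flip-forbidden₃)) ⟩
  ((isOdd (P₀ G) xor isOdd (P₁ G)) xor isOdd (P₁ G)) xor isOdd (P₀ G)
    ≡⟨ xor-pairs-cancel (isOdd (P₀ G)) (isOdd (P₁ G)) ⟩
  false
    ∎)
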